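{- Every perfect binary tree is odd prime.
   Context: All graphs are finite and simple. An odd prime labeling of a graph $G$ with $N$ vertices is a bijection $\ell:V(G)\to\{1,3,\dots,2N-1\}$ such that $\gcd(\ell(u),\ell(v))=1$ for every edge $uv$; $G$ is odd prime if it has one. A perfect binary tree with $n\ge 1$ levels is a rooted tree in which every non-leaf vertex has exactly two children and all leaves lie on the same level; equivalently, level $i$ ($1\le i\le n$) has $2^{i-1}$ vertices, and it has $2^n-1$ vertices in total. -}

module Defs where

open import Data.Nat using (ℕ; suc; _+_; _*_; _∸_; _^_)
open import Data.Nat.GCD using (gcd)
open import Data.Fin using (Fin; toℕ)
open import Data.Product using (Σ; _×_)
open import Data.Sum using (_⊎_; inj₁; inj₂)
open import Data.Nat.Properties using (<-irrefl; ≤-trans; m≤m+n; ≤-refl; n≤1+n)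
open import Data.Nat using (_<_; s≤s; z≤n)
open import Relation.Binary.PropositionalEquality using (subst) renaming (sym to ≡-sym)
open import Function.Bundles using (_⤖_; Bijection)
open import Relation.Binary.PropositionalEquality using (_≡_)
open import Relation.Nullary using (¬_)

record Graph : Set₁ where
  field
    N     : ℕ
    Adj   : Fin N → Fin N → Set
    sym   : ∀ {u v} → Adj u v → Adj v u
    irrefl : ∀ {v} → ¬ Adj v v

odd : ℕ → ℕ
odd k = 2 * k + 1

-- An odd prime labeling: a bijection from the vertices onto {1,3,…,2N-1},
-- encoded as a bijection σ : Fin N ⤖ Fin N with ℓ(v) = 2·σ(v)+1,
-- such that adjacent vertices have coprime labels.
record OddPrimeLabeling (G : Graph) : Set where
  open Graph G
  field
    σ       : Fin N ⤖ Fin N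
  label : Fin N → ℕ
  label v = odd (toℕ (Bijection.to σ v))
  field
    coprime : ∀ {u v} → Adj u v → gcd (label u) (label v) ≡ 1

IsOddPrime : Graph → Set
IsOddPrime G = OddPrimeLabeling G

-- Perfect binary tree with n levels, heap-indexed: vertex i : Fin (2^n - 1)
-- stands for the number i+1 ∈ {1,…,2^n-1}; the children of a are 2a and 2a+1.
-- So a — b is an edge iff b = 2a or b = 2a+1 (or symmetrically).
TreeParent : ℕ → ℕ → Set
TreeParent a b = (b ≡ 2 * a) ⊎ (b ≡ 2 * a + 1)

PBTAdj : ∀ n → Fin (2 ^ n ∸ 1) → Fin (2 ^ n ∸ 1) → Set
PBTAdj n u v = TreeParent (suc (toℕ u)) (suc (toℕ v)) ⊎ TreeParent (suc (toℕ v)) (suc (toℕ u))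

private
  lt1 : ∀ a → suc a < 2 * suc a
  lt1 a = s≤s (subst (a <_) (≡-sym (+-suc a (a + 0))) (s≤s (m≤m+n a (a + 0))))
    where open import Data.Nat.Properties using (+-suc)
  tp-irrefl : ∀ a → ¬ TreeParent (suc a) (suc a)
  tp-irrefl a (inj₁ e) = <-irrefl e (lt1 a)
  tp-irrefl a (inj₂ e) = <-irrefl e (≤-trans (lt1 a) (m≤m+n _ 1))
  ⊎-swap : ∀ {A B : Set} → A ⊎ B → B ⊎ A
  ⊎-swap (inj₁ x) = inj₂ x
  ⊎-swap (inj₂ y) = inj₁ y
  pbt-irrefl : ∀ n {v} → ¬ PBTAdj n v v
  pbt-irrefl n {v} (inj₁ t) = tp-irrefl (toℕ v) t
  pbt-irrefl n {v} (inj₂ t) = tp-irrefl (toℕ v) t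

PerfectBinaryTree : ℕ → Graph
PerfectBinaryTree n = record
  { N = 2 ^ n ∸ 1
  ; Adj = PBTAdj n
  ; sym = ⊎-swap
  ; irrefl = pbt-irrefl n
  }

{-# OPTIONS --safe #-}
-- Number the vertices 1,…,N in heap order, so that the children of k are 2k and 2k+1.
-- Labelling vertex k by 2k+1 makes every edge coprime, as 2(2k+1) = (4k+1) + 1 and
-- 4k+3 = 2(2k+1) + 1. This uses 3,5,…,2N+1; giving the last vertex N, which is a leaf
-- and so the larger end of its only edge, the label 1 instead yields exactly 1,3,…,2N-1.
module Submission where

open import Defs
open import Data.Nat using (ℕ; zero; suc; _+_; _*_; _<_; _≥_)
open import Data.Nat.Properties using (_≟_; m<m+n; m≤m+n; ≤-trans; <-≤-trans; ≤-pred; <⇒≢)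
open import Data.Nat.Divisibility using (_∣_; ∣m+n∣m⇒∣n; ∣n⇒∣m*n; ∣1⇒≡1)
open import Data.Nat.Coprimality as Coprimality using (Coprime; coprime⇒gcd≡1; 1-coprimeTo)
open import Data.Nat.Tactic.RingSolver using (solve-∀)
open import Data.Fin using (Fin; toℕ; fromℕ; punchIn; punchOut) renaming (zero to fzero; suc to fsuc; _≟_ to _≟ᶠ_)
open import Data.Fin.Properties using (toℕ-fromℕ; toℕ<n; toℕ-injective; punchIn-punchOut)
open import Data.Fin.Permutation using (Permutation′; insert; id; _⟨$⟩ʳ_; insert-punchIn)
open import Data.Product using (_,_)
open import Data.Sum using (_⊎_; inj₁; inj₂)
open import Data.Nat.GCD using (gcd)
open import Function using (_∘_)
open import Function.Properties.Inverse using (↔⇒⤖)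
open import Relation.Binary.PropositionalEquality using (_≡_; _≢_; refl; sym; trans; cong; subst; subst₂; module ≡-Reasoning)
open import Relation.Nullary using (yes; no; contradiction)

*≡+1⇒coprime : ∀ k {m n} → k * m ≡ n + 1 → Coprime m n
*≡+1⇒coprime k eq {d} (d∣m , d∣n) = ∣1⇒≡1 (∣m+n∣m⇒∣n (subst (d ∣_) eq (∣n⇒∣m*n k d∣m)) d∣n)

≡*+1⇒coprime : ∀ k {m n} → n ≡ k * m + 1 → Coprime m n
≡*+1⇒coprime k eq {d} (d∣m , d∣n) = ∣1⇒≡1 (∣m+n∣m⇒∣n (subst (d ∣_) eq d∣n) (∣n⇒∣m*n k d∣m))

2*odd≡odd[2*]+1 : ∀ p → 2 * odd p ≡ odd (2 * p) + 1
2*odd≡odd[2*]+1 = expanded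
  where expanded : ∀ p → 2 * (2 * p + 1) ≡ (2 * (2 * p) + 1) + 1
        expanded = solve-∀

TreeParent⇒coprime-odd : ∀ {p c} → TreeParent p c → Coprime (odd p) (odd c)
TreeParent⇒coprime-odd {p} (inj₁ refl) = *≡+1⇒coprime 2 (2*odd≡odd[2*]+1 p)
TreeParent⇒coprime-odd {p} (inj₂ refl) = ≡*+1⇒coprime 2 refl

TreeParent⇒< : ∀ {a c} → TreeParent (suc a) c → suc a < c
TreeParent⇒< {a} (inj₁ refl) = m<m+n (suc a) (m≤m+n 1 (a + 0))
TreeParent⇒< {a} (inj₂ refl) = ≤-trans (m<m+n (suc a) (m≤m+n 1 (a + 0))) (m≤m+n _ 1)

toℕ-punchIn-fromℕ : ∀ {m} (k : Fin m) → toℕ (punchIn (fromℕ m) k) ≡ toℕ k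
toℕ-punchIn-fromℕ fzero    = refl
toℕ-punchIn-fromℕ (fsuc k) = cong suc (toℕ-punchIn-fromℕ k)

module _ {m : ℕ} where

  rotateLast : Permutation′ (suc m)
  rotateLast = insert (fromℕ m) fzero id

  rotateLast-fromℕ : rotateLast ⟨$⟩ʳ fromℕ m ≡ fzero
  rotateLast-fromℕ with fromℕ m ≟ᶠ fromℕ m
  ... | yes _ = refl
  ... | no ne = contradiction refl ne

  toℕ-rotateLast-≡ : ∀ v → toℕ v ≡ m → toℕ (rotateLast ⟨$⟩ʳ v) ≡ 0
  toℕ-rotateLast-≡ v v≡m rewrite toℕ-injective (trans v≡m (sym (toℕ-fromℕ m))) = cong toℕ rotateLast-fromℕ

  toℕ-rotateLast-≢ : ∀ v → toℕ v ≢ m → toℕ (rotateLast ⟨$⟩ʳ v) ≡ suc (toℕ v)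
  toℕ-rotateLast-≢ v v≢m = begin
    toℕ (rotateLast ⟨$⟩ʳ v)                  ≡⟨ cong (toℕ ∘ (rotateLast ⟨$⟩ʳ_)) (sym punchIn-k≡v) ⟩
    toℕ (rotateLast ⟨$⟩ʳ punchIn (fromℕ m) k) ≡⟨ cong toℕ (insert-punchIn (fromℕ m) fzero id k) ⟩
    suc (toℕ k)                              ≡⟨ cong suc (sym (toℕ-punchIn-fromℕ k)) ⟩
    suc (toℕ (punchIn (fromℕ m) k))          ≡⟨ cong (suc ∘ toℕ) punchIn-k≡v ⟩
    suc (toℕ v)                              ∎
    where
    open ≡-Reasoning
    fromℕ≢v : fromℕ m ≢ v
    fromℕ≢v eq = v≢m (trans (cong toℕ (sym eq)) (toℕ-fromℕ m))
    k : Fin m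
    k = punchOut fromℕ≢v
    punchIn-k≡v : punchIn (fromℕ m) k ≡ v
    punchIn-k≡v = punchIn-punchOut fromℕ≢v

HeapAdj : ∀ {N} → Fin N → Fin N → Set
HeapAdj u v = TreeParent (suc (toℕ u)) (suc (toℕ v)) ⊎ TreeParent (suc (toℕ v)) (suc (toℕ u))

heapLabel : ∀ {m} → Fin (suc m) → ℕ
heapLabel v = odd (toℕ (rotateLast ⟨$⟩ʳ v))

heapLabel-coprime : ∀ {m} (u v : Fin (suc m)) → TreeParent (suc (toℕ u)) (suc (toℕ v)) →
                    Coprime (heapLabel u) (heapLabel v)
heapLabel-coprime {m} u v parent with toℕ v ≟ m
... | yes v≡m = subst (Coprime (heapLabel u)) (cong odd (sym (toℕ-rotateLast-≡ v v≡m)))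
                  (Coprimality.sym (1-coprimeTo (heapLabel u)))
... | no v≢m = subst₂ Coprime (cong odd (sym (toℕ-rotateLast-≢ u u≢m)))
                              (cong odd (sym (toℕ-rotateLast-≢ v v≢m)))
                              (TreeParent⇒coprime-odd {suc (toℕ u)} parent)
  where
  u≢m : toℕ u ≢ m
  u≢m = <⇒≢ (<-≤-trans (≤-pred (TreeParent⇒< parent)) (≤-pred (toℕ<n v)))

heapSubgraph-isOddPrime : (G : Graph) → (∀ {u v} → Graph.Adj G u v → HeapAdj u v) → IsOddPrime G
heapSubgraph-isOddPrime record { N = zero } _ = record { σ = ↔⇒⤖ id ; coprime = λ { {()} } }
heapSubgraph-isOddPrime record { N = suc m } heap = record { σ = ↔⇒⤖ rotateLast ; coprime = coprime ∘ heap }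
  where
  coprime : ∀ {u v : Fin (suc m)} → HeapAdj u v → gcd (heapLabel u) (heapLabel v) ≡ 1
  coprime {u} {v} (inj₁ parent) = coprime⇒gcd≡1 (heapLabel-coprime u v parent)
  coprime {u} {v} (inj₂ child)  = coprime⇒gcd≡1 (Coprimality.sym (heapLabel-coprime v u child))

mainTheorem12 : ∀ (n : ℕ) → n ≥ 1 → IsOddPrime (PerfectBinaryTree n)
mainTheorem12 n _ = heapSubgraph-isOddPrime (PerfectBinaryTree n) (λ adj → adj)
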